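{- Let $n\ge1$ and $k$ be integers with $n/2<k\le n$. Let $A$ be an $n\times n$ matrix with entries in $\{0,1\}$ such that every $k\times k$ minor of $A$ contains at least one entry equal to $1$. Then the number of entries of $A$ equal to $1$ is at least $2(n-k)+1$. Moreover, if this number is exactly $2(n-k)+1$, then $A$ is uniquely determined up to permutations of rows and columns (i.e. any two such matrices with exactly $2(n-k)+1$ ones can be obtained from one another by permuting rows and columns).
   Context: A $k\times k$ minor of an $n\times n$ matrix means the $k\times k$ submatrix formed by the entries lying in some chosen $k$ rows and some chosen $k$ columns. -}

module Defs where

open import Data.Nat using (ℕ)
open import Data.Bool using (Bool; true; false)
open import Data.Fin using (Fin)
open import Data.Vec using (sum; tabulate)
open import Data.Fin.Permutation using (Permutation′; _⟨$⟩ʳ_)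
open import Data.Product using (∃; ∃₂; _×_)
open import Function.Bundles using (_↣_; Injection)
open import Relation.Binary.PropositionalEquality using (_≡_)

BMatrix : ℕ → Set
BMatrix n = Fin n → Fin n → Bool

-- A k×k minor is given by a choice of k distinct rows and k distinct
-- columns, i.e. injections Fin k ↣ Fin n.  The minor contains a 1.
MinorHasOne : ∀ {n k} → BMatrix n → (Fin k ↣ Fin n) → (Fin k ↣ Fin n) → Set
MinorHasOne A r c =
  ∃₂ λ (i j : Fin _) → A (Injection.to r i) (Injection.to c j) ≡ true

EveryMinorHasOne : ∀ {n} → ℕ → BMatrix n → Set
EveryMinorHasOne {n} k A =
  (r c : Fin k ↣ Fin n) → MinorHasOne A r c

bit : Bool → ℕ
bit true = 1
bit false = 0

countOnes : ∀ {n} → BMatrix n → ℕ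
countOnes {n} A = sum (tabulate λ i → sum (tabulate λ j → bit (A i j)))

PermEquiv : ∀ {n} → BMatrix n → BMatrix n → Set
PermEquiv {n} A B =
  ∃₂ λ (σ τ : Permutation′ n) → ∀ i j → B i j ≡ A (σ ⟨$⟩ʳ i) (τ ⟨$⟩ʳ j)

-- Let m = n - k.  If the ones of A could be covered by m rows and m
-- columns, the other k rows and k columns would span a minor of zeros.
-- Any 2m positions can be covered by m rows (those of the first m) and
-- m columns (those of the rest), so A has at least 2m + 1 ones.  If it
-- has exactly 2m + 1 and two of them share a row, that row together with
-- m - 1 rows and m columns covering the other 2m - 1 ones is again such a
-- cover.  Hence the ones lie in distinct rows and distinct columns: A is
-- a partial permutation matrix of size 2m + 1, and any two of these are
-- related by permuting rows and columns.

module Submission where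

open import Defs
open import Data.Bool using (Bool; true; false)
open import Data.Bool.Properties using () renaming (_≟_ to _≟ᵇ_)
open import Data.Empty using (⊥-elim)
open import Data.Fin using (Fin; zero; suc; inject≤)
import Data.Fin.Properties as Fin
open import Data.Fin.Permutation using (Permutation′; _⟨$⟩ʳ_; _∘ₚ_; transpose)
import Data.Fin.Permutation as Permutation
import Data.Fin.Permutation.Components as PC
open import Data.List using (List; []; _∷_; _++_; length; lookup; filter; take; drop; map; allFin; tabulate; cartesianProduct)
import Data.List.Properties as List
open import Data.List.Membership.Propositional using (_∈_; _∉_)
open import Data.List.Membership.Propositional.Properties
  using (∈-lookup; ∈-filter⁺; ∈-filter⁻; ∈-map⁺; ∈-allFin; ∈-cartesianProduct⁺; ∈-++⁻)
import Data.List.Membership.DecPropositional as DecMembership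
import Data.List.Membership.Setoid.Properties as SetoidMembership
open import Data.List.Relation.Binary.Subset.Propositional using (_⊆_)
open import Data.List.Relation.Unary.Any using (here; there; index)
open import Data.List.Relation.Unary.Any.Properties using (lookup-index)
import Data.List.Relation.Unary.All as All
open import Data.List.Relation.Unary.AllPairs using ([]; _∷_)
open import Data.List.Relation.Unary.Unique.Propositional using (Unique)
import Data.List.Relation.Unary.Unique.Propositional.Properties as Unique
open import Data.Nat using (ℕ; zero; suc; _+_; _*_; _∸_; _≤_; _<_; s≤s; s≤s⁻¹)
open import Data.Nat.Properties
open import Data.Nat.Tactic.RingSolver using (solve-∀)
open import Data.Product using (∃; ∃₂; _×_; _,_; proj₁; proj₂; swap; uncurry)
open import Data.Product.Properties using (≡-dec)
open import Data.Sum using (_⊎_; inj₁; [_,_])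
import Data.Sum as Sum
import Data.Vec as Vec
import Data.Vec.Properties as Vec
open import Function using (_∘_)
open import Function.Bundles using (_↣_; mk↣; Injection; _⇔_; mk⇔; Equivalence)
open import Function.Definitions using (Injective)
import Function.Properties.Equivalence as ⇔
open import Function.Properties.Inverse using (↔⇒↣)
open import Relation.Binary.Definitions using (DecidableEquality)
open import Relation.Binary.PropositionalEquality
  using (_≡_; _≢_; refl; sym; trans; cong; cong₂; subst; setoid; module ≡-Reasoning)
open import Relation.Nullary using (¬_; yes; no; does)
open import Relation.Unary using (Pred; Decidable)
open import Relation.Unary.Properties using (∁?)

private
  variable
    A X Y : Set
    n k N : ℕ

lookup-injective : ∀ {xs : List A} → Unique xs → Injective _≡_ _≡_ (lookup xs)
lookup-injective (_ ∷ _) {zero} {zero} _ = refl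
lookup-injective (x∉ ∷ _) {zero} {suc j} eq = ⊥-elim (All.lookup x∉ (∈-lookup j) eq)
lookup-injective (x∉ ∷ _) {suc i} {zero} eq = ⊥-elim (All.lookup x∉ (∈-lookup i) (sym eq))
lookup-injective (_ ∷ u) {suc i} {suc j} eq = cong suc (lookup-injective u eq)

∈⇔lookup : ∀ {x} {xs : List A} → x ∈ xs ⇔ ∃ λ i → lookup xs i ≡ x
∈⇔lookup = mk⇔ (λ x∈ → index x∈ , sym (lookup-index x∈)) (λ { (i , refl) → ∈-lookup i })

Unique-⊆⇒length≤ : ∀ {xs ys : List A} → Unique xs → xs ⊆ ys → length xs ≤ length ys
Unique-⊆⇒length≤ {xs = xs} unique xs⊆ys = Fin.injective⇒≤ position-injective
  where
  position : Fin (length xs) → Fin _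
  position i = index (xs⊆ys (∈-lookup i))

  position-injective : Injective _≡_ _≡_ position
  position-injective eq =
    lookup-injective unique (SetoidMembership.index-injective (setoid _) _ _ eq)

length-filter+length-filter-∁ : ∀ {ℓ} {P : Pred A ℓ} (P? : Decidable P) xs →
  length (filter P? xs) + length (filter (∁? P?) xs) ≡ length xs
length-filter+length-filter-∁ P? [] = refl
length-filter+length-filter-∁ P? (x ∷ xs) with does (P? x)
... | true = cong suc (length-filter+length-filter-∁ P? xs)
... | false = trans (+-suc _ _) (cong suc (length-filter+length-filter-∁ P? xs))

2*m+1≡1+m+m : ∀ m → 2 * m + 1 ≡ suc (m + m)
2*m+1≡1+m+m = solve-∀

m<n+n⇒m∸n<n : ∀ m n → m < n + n → m ∸ n < n
m<n+n⇒m∸n<n m (suc n) lt = m<n+o⇒m∸n<o m (suc n) lt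

Covers : List (X × Y) → List X → List Y → Set
Covers L R C = ∀ {p} → p ∈ L → proj₁ p ∈ R ⊎ proj₂ p ∈ C

Uncoverable : ℕ → List (X × Y) → Set
Uncoverable m L = ∀ R C → length R ≤ m → length C ≤ m → ¬ Covers L R C

RowsDistinct ColsDistinct : List (X × Y) → Set
RowsDistinct L = ∀ {p q} → p ∈ L → q ∈ L → proj₁ p ≡ proj₁ q → p ≡ q
ColsDistinct L = ∀ {p q} → p ∈ L → q ∈ L → proj₂ p ≡ proj₂ q → p ≡ q

split-cover : ∀ a b (L : List (X × Y)) → length L ≤ a + b →
  ∃₂ λ R C → length R ≤ a × length C ≤ b × Covers L R C
split-cover a b L |L|≤a+b = map proj₁ (take a L) , map proj₂ (drop a L) , |R|≤a , |C|≤b , covers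
  where
  |R|≤a : length (map proj₁ (take a L)) ≤ a
  |R|≤a = subst (_≤ a) (sym (trans (List.length-map proj₁ (take a L)) (List.length-take a L)))
            (m⊓n≤m a (length L))

  |C|≤b : length (map proj₂ (drop a L)) ≤ b
  |C|≤b = subst (_≤ b) (sym (trans (List.length-map proj₂ (drop a L)) (List.length-drop a L)))
            (m≤n+o⇒m∸n≤o (length L) a |L|≤a+b)

  covers : Covers L (map proj₁ (take a L)) (map proj₂ (drop a L))
  covers {p} p∈L = Sum.map (∈-map⁺ proj₁) (∈-map⁺ proj₂)
    (∈-++⁻ (take a L) (subst (p ∈_) (sym (List.take++drop≡id a L)) p∈L))

uncoverable⇒length : ∀ {m} {L : List (X × Y)} → Uncoverable m L → 2 * m + 1 ≤ length L
uncoverable⇒length {m = m} {L = L} unc = ≮⇒≥ λ |L|<2m+1 →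
  let R , C , |R|≤m , |C|≤m , covers =
        split-cover m m L (s≤s⁻¹ (subst (length L <_) (2*m+1≡1+m+m m) |L|<2m+1))
  in unc R C |R|≤m |C|≤m covers

uncoverable-swap : ∀ {m} {L : List (X × Y)} → Uncoverable m L → Uncoverable m (map swap L)
uncoverable-swap unc R C |R|≤m |C|≤m covers =
  unc C R |C|≤m |R|≤m (Sum.swap ∘ covers ∘ ∈-map⁺ swap)

uncoverable⇒rowsDistinct : DecidableEquality X → DecidableEquality Y →
  ∀ {m} {L : List (X × Y)} → Uncoverable m L → length L ≤ 2 * m + 1 → RowsDistinct L
uncoverable⇒rowsDistinct {X} {Y} _≟ˣ_ _≟ʸ_ {m} {L} unc |L|≤2m+1 {x} {y} x∈L y∈L same-row
  with ≡-dec _≟ˣ_ _≟ʸ_ x y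
... | yes x≡y = x≡y
... | no x≢y =
  let R , C , |R|≤o∸m , |C|≤m , covers = split-cover (o ∸ m) m offRow o≤[o∸m]+m
  in ⊥-elim (unc (proj₁ x ∷ R) C (≤-trans (s≤s |R|≤o∸m) (m<n+n⇒m∸n<n o m o<m+m)) |C|≤m
                 (add-row covers))
  where
  in-row? = λ (p : X × Y) → proj₁ p ≟ˣ proj₁ x
  inRow = filter in-row? L
  offRow = filter (∁? in-row?) L
  o = length offRow

  2≤|inRow| : 2 ≤ length inRow
  2≤|inRow| = Unique-⊆⇒length≤ ((x≢y All.∷ All.[]) ∷ All.[] ∷ []) λ where
    (here refl) → ∈-filter⁺ in-row? x∈L refl
    (there (here refl)) → ∈-filter⁺ in-row? y∈L (sym same-row)

  o<m+m : o < m + m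
  o<m+m = s≤s⁻¹ (begin
    2 + o                  ≤⟨ +-monoˡ-≤ o 2≤|inRow| ⟩
    length inRow + o       ≡⟨ length-filter+length-filter-∁ in-row? L ⟩
    length L               ≤⟨ |L|≤2m+1 ⟩
    2 * m + 1              ≡⟨ 2*m+1≡1+m+m m ⟩
    suc (m + m)            ∎)
    where open ≤-Reasoning

  o≤[o∸m]+m : o ≤ (o ∸ m) + m
  o≤[o∸m]+m = subst (o ≤_) (+-comm m (o ∸ m)) (m≤n+m∸n o m)

  add-row : ∀ {R C} → Covers offRow R C → Covers L (proj₁ x ∷ R) C
  add-row covers {p} p∈L with in-row? p
  ... | yes p-in-row = inj₁ (here p-in-row)
  ... | no p-off-row = Sum.map₁ there (covers (∈-filter⁺ (∁? in-row?) p∈L p-off-row))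

uncoverable⇒colsDistinct : DecidableEquality X → DecidableEquality Y →
  ∀ {m} {L : List (X × Y)} → Uncoverable m L → length L ≤ 2 * m + 1 → ColsDistinct L
uncoverable⇒colsDistinct _≟ˣ_ _≟ʸ_ {L = L} unc |L|≤2m+1 x∈L y∈L same-col =
  cong swap (uncoverable⇒rowsDistinct _≟ʸ_ _≟ˣ_ (uncoverable-swap unc)
    (subst (_≤ _) (sym (List.length-map swap L)) |L|≤2m+1)
    (∈-map⁺ swap x∈L) (∈-map⁺ swap y∈L) same-col)

transpose-sendsˡ : ∀ (i j : Fin n) → PC.transpose i j i ≡ j
transpose-sendsˡ i j with i Fin.≟ i
... | yes _ = refl
... | no i≢i = ⊥-elim (i≢i refl)

transpose-fixes : ∀ (i j l : Fin n) → l ≢ i → l ≢ j → PC.transpose i j l ≡ l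
transpose-fixes i j l l≢i l≢j with l Fin.≟ i
... | yes l≡i = ⊥-elim (l≢i l≡i)
... | no _ with l Fin.≟ j
...   | yes l≡j = ⊥-elim (l≢j l≡j)
...   | no _ = refl

permutation-injective : ∀ (π : Permutation′ n) → Injective _≡_ _≡_ (π ⟨$⟩ʳ_)
permutation-injective π = Injection.injective (↔⇒↣ π)

extend-to-permutation : ∀ (e f : Fin N → Fin n) → Injective _≡_ _≡_ e → Injective _≡_ _≡_ f →
  ∃ λ (π : Permutation′ n) → ∀ t → π ⟨$⟩ʳ e t ≡ f t
extend-to-permutation {zero} e f _ _ = Permutation.id , λ ()
extend-to-permutation {suc N} e f e-inj f-inj = π′ ∘ₚ transpose (π′ ⟨$⟩ʳ e zero) (f zero) , sends
  where
  IH = extend-to-permutation (e ∘ suc) (f ∘ suc) (Fin.suc-injective ∘ e-inj) (Fin.suc-injective ∘ f-inj)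
  π′ = proj₁ IH

  sends : ∀ t → PC.transpose (π′ ⟨$⟩ʳ e zero) (f zero) (π′ ⟨$⟩ʳ e t) ≡ f t
  sends zero = transpose-sendsˡ (π′ ⟨$⟩ʳ e zero) (f zero)
  sends (suc t) = begin
    PC.transpose (π′ ⟨$⟩ʳ e zero) (f zero) (π′ ⟨$⟩ʳ e (suc t)) ≡⟨ cong (PC.transpose _ _) (proj₂ IH t) ⟩
    PC.transpose (π′ ⟨$⟩ʳ e zero) (f zero) (f (suc t))          ≡⟨ transpose-fixes _ _ _ f≢π′e₀ f≢f₀ ⟩
    f (suc t)                                                   ∎
    where
    open ≡-Reasoning
    f≢π′e₀ : f (suc t) ≢ π′ ⟨$⟩ʳ e zero
    f≢π′e₀ eq with () ← e-inj (permutation-injective π′ (trans (proj₂ IH t) eq))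
    f≢f₀ : f (suc t) ≢ f zero
    f≢f₀ eq with () ← f-inj eq

length-filter-tabulate : ∀ {ℓ} {P : Pred A ℓ} (P? : Decidable P) (g : Fin N → A) →
  length (filter P? (tabulate g)) ≡ Vec.sum (Vec.tabulate (bit ∘ does ∘ P? ∘ g))
length-filter-tabulate {N = zero} P? g = refl
length-filter-tabulate {N = suc N} P? g with does (P? (g zero))
... | true = cong suc (length-filter-tabulate P? (g ∘ suc))
... | false = length-filter-tabulate P? (g ∘ suc)

length-filter-cartesianProduct : ∀ {ℓ} {P : Pred (X × Y) ℓ} (P? : Decidable P)
  (f : Fin N → X) (g : Fin n → Y) →
  length (filter P? (cartesianProduct (tabulate f) (tabulate g)))
    ≡ Vec.sum (Vec.tabulate λ i → Vec.sum (Vec.tabulate λ j → bit (does (P? (f i , g j)))))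
length-filter-cartesianProduct {N = zero} P? f g = refl
length-filter-cartesianProduct {N = suc N} P? f g = begin
  length (filter P? (map (f zero ,_) (tabulate g) ++ rest))
    ≡⟨ cong length (List.filter-++ P? (map (f zero ,_) (tabulate g)) rest) ⟩
  length (filter P? (map (f zero ,_) (tabulate g)) ++ filter P? rest)
    ≡⟨ List.length-++ (filter P? (map (f zero ,_) (tabulate g))) ⟩
  length (filter P? (map (f zero ,_) (tabulate g))) + length (filter P? rest)
    ≡⟨ cong₂ _+_ first-row (length-filter-cartesianProduct P? (f ∘ suc) g) ⟩
  _ ∎
  where
  open ≡-Reasoning
  rest = cartesianProduct (tabulate (f ∘ suc)) (tabulate g)
  first-row = trans (cong (length ∘ filter P?) (List.map-tabulate g (f zero ,_)))
                    (length-filter-tabulate P? ((f zero ,_) ∘ g))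

module _ {n} (A : BMatrix n) where

  is-one? : Decidable (λ (p : Fin n × Fin n) → uncurry A p ≡ true)
  is-one? p = uncurry A p ≟ᵇ true

  ones : List (Fin n × Fin n)
  ones = filter is-one? (cartesianProduct (allFin n) (allFin n))

  ones-unique : Unique ones
  ones-unique = Unique.filter⁺ is-one? (Unique.cartesianProduct⁺ (Unique.allFin⁺ n) (Unique.allFin⁺ n))

  ∈-ones : ∀ {i j} → A i j ≡ true ⇔ (i , j) ∈ ones
  ∈-ones {i} {j} = mk⇔ (∈-filter⁺ is-one? (∈-cartesianProduct⁺ (∈-allFin i) (∈-allFin j)))
                       (proj₂ ∘ ∈-filter⁻ is-one? {xs = cartesianProduct (allFin n) (allFin n)})

  length-ones : length ones ≡ countOnes A
  length-ones = trans (length-filter-cartesianProduct is-one? (λ i → i) (λ j → j))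
    (cong Vec.sum (Vec.tabulate-cong λ i → cong Vec.sum (Vec.tabulate-cong λ j → bit-does (A i j))))
    where
    bit-does : ∀ b → bit (does (b ≟ᵇ true)) ≡ bit b
    bit-does true = refl
    bit-does false = refl

↣-avoiding : (R : List (Fin n)) → length R + k ≤ n →
  ∃ λ (r : Fin k ↣ Fin n) → ∀ i → Injection.to r i ∉ R
↣-avoiding {n} {k} R |R|+k≤n =
  mk↣ {to = enumerate} (Fin.inject≤-injective _ _ _ _ ∘ lookup-injective outside-unique) ,
  λ i → proj₂ (∈-filter⁻ (∁? (_∈? R)) {xs = allFin n} (∈-lookup _))
  where
  open DecMembership (Fin._≟_ {n}) using (_∈?_)
  inside = filter (_∈? R) (allFin n)
  outside = filter (∁? (_∈? R)) (allFin n)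

  outside-unique : Unique outside
  outside-unique = Unique.filter⁺ (∁? (_∈? R)) (Unique.allFin⁺ n)

  |inside|≤|R| : length inside ≤ length R
  |inside|≤|R| = Unique-⊆⇒length≤ (Unique.filter⁺ (_∈? R) (Unique.allFin⁺ n))
                                  (proj₂ ∘ ∈-filter⁻ (_∈? R) {xs = allFin n})

  k≤|outside| : k ≤ length outside
  k≤|outside| = +-cancelˡ-≤ (length inside) k (length outside) (begin
    length inside + k                ≤⟨ +-monoˡ-≤ k |inside|≤|R| ⟩
    length R + k                     ≤⟨ |R|+k≤n ⟩
    n                                ≡⟨ List.length-tabulate (λ i → i) ⟨
    length (allFin n)                ≡⟨ length-filter+length-filter-∁ (_∈? R) (allFin n) ⟨
    length inside + length outside   ∎)
    where open ≤-Reasoning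

  enumerate : Fin k → Fin n
  enumerate i = lookup outside (inject≤ i k≤|outside|)

everyMinorHasOne⇒uncoverable : ∀ {m} (A : BMatrix n) → EveryMinorHasOne k A → m + k ≤ n →
  Uncoverable m (ones A)
everyMinorHasOne⇒uncoverable {k = k} A every m+k≤n R C |R|≤m |C|≤m covers =
  let r , r∉R = ↣-avoiding R (≤-trans (+-monoˡ-≤ k |R|≤m) m+k≤n)
      c , c∉C = ↣-avoiding C (≤-trans (+-monoˡ-≤ k |C|≤m) m+k≤n)
      i , j , Aij≡1 = every r c
  in [ r∉R i , c∉C j ] (covers (Equivalence.to (∈-ones A) Aij≡1))

record IsPartialPermutation (A : BMatrix n) (e : Fin N → Fin n × Fin n) : Set where
  field
    rows-injective : Injective _≡_ _≡_ (proj₁ ∘ e)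
    cols-injective : Injective _≡_ _≡_ (proj₂ ∘ e)
    ones-image : ∀ {i j} → A i j ≡ true ⇔ ∃ λ t → e t ≡ (i , j)

ones-isPartialPermutation : (A : BMatrix n) → RowsDistinct (ones A) → ColsDistinct (ones A) →
  IsPartialPermutation A (lookup (ones A))
ones-isPartialPermutation A rows-distinct cols-distinct = record
  { rows-injective = lookup-injective (ones-unique A) ∘ rows-distinct (∈-lookup _) (∈-lookup _)
  ; cols-injective = lookup-injective (ones-unique A) ∘ cols-distinct (∈-lookup _) (∈-lookup _)
  ; ones-image = ⇔.trans (∈-ones A) ∈⇔lookup
  }

≡true⇔≡true⇒≡ : ∀ {a b : Bool} → a ≡ true ⇔ b ≡ true → a ≡ b
≡true⇔≡true⇒≡ {true} a⇔b = sym (Equivalence.to a⇔b refl)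
≡true⇔≡true⇒≡ {false} {true} a⇔b = Equivalence.from a⇔b refl
≡true⇔≡true⇒≡ {false} {false} _ = refl

partialPermutations⇒permEquiv : ∀ {N N′} {A B : BMatrix n} {a : Fin N → Fin n × Fin n}
  {b : Fin N′ → Fin n × Fin n} → N ≡ N′ → IsPartialPermutation A a → IsPartialPermutation B b →
  PermEquiv A B
partialPermutations⇒permEquiv {A = A} {B} {a} {b} refl PA PB =
  σ , τ , λ i j → ≡true⇔≡true⇒≡ (mk⇔ (forward i j) (backward i j))
  where
  module PA = IsPartialPermutation PA
  module PB = IsPartialPermutation PB
  σ-spec = extend-to-permutation (proj₁ ∘ b) (proj₁ ∘ a) PB.rows-injective PA.rows-injective
  τ-spec = extend-to-permutation (proj₂ ∘ b) (proj₂ ∘ a) PB.cols-injective PA.cols-injective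
  σ = proj₁ σ-spec
  τ = proj₁ τ-spec

  forward : ∀ i j → B i j ≡ true → A (σ ⟨$⟩ʳ i) (τ ⟨$⟩ʳ j) ≡ true
  forward i j Bij with t , refl ← Equivalence.to PB.ones-image Bij =
    Equivalence.from PA.ones-image (t , cong₂ _,_ (sym (proj₂ σ-spec t)) (sym (proj₂ τ-spec t)))

  backward : ∀ i j → A (σ ⟨$⟩ʳ i) (τ ⟨$⟩ʳ j) ≡ true → B i j ≡ true
  backward i j Aσiτj with t , at≡σi,τj ← Equivalence.to PA.ones-image Aσiτj =
    Equivalence.from PB.ones-image (t , cong₂ _,_
      (permutation-injective σ (trans (proj₂ σ-spec t) (cong proj₁ at≡σi,τj)))
      (permutation-injective τ (trans (proj₂ τ-spec t) (cong proj₂ at≡σi,τj))))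

-- The hypotheses 1 ≤ n and n < 2k only guarantee 2(n - k) + 1 ≤ n, i.e.
-- that the extremal matrices exist; the proof does not need them.
lemma7 : (n k : ℕ) → 1 ≤ n → n < 2 * k → k ≤ n →
    ((A : BMatrix n) → EveryMinorHasOne k A →
      2 * (n ∸ k) + 1 ≤ countOnes A)
    × ((A B : BMatrix n) → EveryMinorHasOne k A → EveryMinorHasOne k B →
      countOnes A ≡ 2 * (n ∸ k) + 1 → countOnes B ≡ 2 * (n ∸ k) + 1 →
      PermEquiv A B)
lemma7 n k _ _ k≤n = lower-bound , extremal-unique
  where
  m = n ∸ k

  uncoverable : ∀ {A} → EveryMinorHasOne k A → Uncoverable m (ones A)
  uncoverable {A} every = everyMinorHasOne⇒uncoverable A every (≤-reflexive (m∸n+n≡m k≤n))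

  lower-bound : ∀ A → EveryMinorHasOne k A → 2 * m + 1 ≤ countOnes A
  lower-bound A every = subst (2 * m + 1 ≤_) (length-ones A) (uncoverable⇒length (uncoverable every))

  extremal : ∀ A → EveryMinorHasOne k A → countOnes A ≡ 2 * m + 1 →
    IsPartialPermutation A (lookup (ones A))
  extremal A every count = ones-isPartialPermutation A
    (uncoverable⇒rowsDistinct Fin._≟_ Fin._≟_ (uncoverable every) |ones|≤)
    (uncoverable⇒colsDistinct Fin._≟_ Fin._≟_ (uncoverable every) |ones|≤)
    where
    |ones|≤ = ≤-reflexive (trans (length-ones A) count)

  extremal-unique : ∀ A B → EveryMinorHasOne k A → EveryMinorHasOne k B →
    countOnes A ≡ 2 * m + 1 → countOnes B ≡ 2 * m + 1 → PermEquiv A B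
  extremal-unique A B every-A every-B count-A count-B =
    partialPermutations⇒permEquiv
      (trans (trans (length-ones A) count-A) (sym (trans (length-ones B) count-B)))
      (extremal A every-A count-A) (extremal B every-B count-B)
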